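{- Let $\mathcal I$ be a small step alternating pushdown system and let $\mathcal I_{\neg}$ and $\mathcal I'_{\neg}$ be as defined below. If $A$ is a configuration and $\neg A$ is provable in $\mathcal I'_{\neg}$, then there exist a rule $\frac{\neg C_1\ \cdots\ \neg C_p}{\neg B}$ of $\mathcal I_{\neg}$ and a substitution $\sigma$ with $\sigma B=A$ such that all the premises $\neg\sigma C_1,\dots,\neg\sigma C_p$ are provable in $\mathcal I'_{\neg}$.
   Context: Fix a language with finitely many unary predicate symbols (states), finitely many unary function symbols (stack symbols), a constant $\varepsilon$ and a variable $x$. Words are closed terms $\gamma_1(\cdots\gamma_n(\varepsilon))$; configurations are atomic propositions $P(w)$ with $P$ a state and $w$ a word. Besides atomic propositions we use formal negations $\neg A$. For an inference system $\mathcal J$ (rules with finitely many premises, each premise and the conclusion being an atomic proposition or its negation, possibly containing $x$), a proof of a closed proposition $C$ is a finite tree with root $C$ in which each node is labeled $\sigma B$ and its children $\sigma A_1,\dots,\sigma A_n$ for some rule $\frac{A_1\cdots A_n}{B}\in\mathcal J$ and substitution $\sigma$ of a word for $x$. Rule types: an introduction rule is $\frac{P_1(x)\cdots P_n(x)}{Q(\gamma x)}$ ($\gamma$ a stack symbol, $n\ge0$) or $\frac{}{Q(\varepsilon)}$; an elimination rule is $\frac{P_1(\gamma x)\ P_2(x)\cdots P_n(x)}{Q(x)}$ ($n\ge1$); a neutral rule is $\frac{P_1(x)\cdots P_n(x)}{Q(x)}$ ($n\ge0$). A small step alternating pushdown system is a finite set of introduction, elimination and neutral rules; premises of rules are regarded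 as sets. Saturation: $\mathcal I_s$ is the smallest set of rules containing $\mathcal I$ and closed under (1) from an introduction rule $\frac{P_1(x)\cdots P_m(x)}{Q_1(\gamma x)}$ and an elimination rule $\frac{Q_1(\gamma x)\ Q_2(x)\cdots Q_n(x)}{R(x)}$, add $\frac{P_1(x)\cdots P_m(x)\ Q_2(x)\cdots Q_n(x)}{R(x)}$; (2) from introduction rules $\frac{P^i_1(x)\cdots P^i_{m_i}(x)}{Q_i(\gamma x)}$ ($i=1..n$, same $\gamma$) and a neutral rule $\frac{Q_1(x)\cdots Q_n(x)}{R(x)}$ ($n\ge0$), add $\frac{P^1_1(x)\cdots P^n_{m_n}(x)}{R(\gamma x)}$ (all premises together; for $n=0$, $\frac{}{R(\gamma x)}$ for every $\gamma$); (3) from introduction rules $\frac{}{Q_i(\varepsilon)}$ ($i=1..n$) and a neutral rule $\frac{Q_1(x)\cdots Q_n(x)}{R(x)}$ ($n\ge0$), add $\frac{}{R(\varepsilon)}$. $\mathcal I'$ is obtained from $\mathcal I_s$ by removing all elimination and neutral rules. For a small step system $\mathcal J$: $\tilde{\mathcal J}$ keeps the introduction rules of $\mathcal J$ and replaces each neutral or elimination rule (conclusion $P(x)$) by its instance with $x:=\varepsilon$ and its instances with $x:=\gamma x$ for every stack symbol $\gamma$; $\mathcal C$ is the set of all $P(\varepsilon)$, $P(\gamma x)$. Then $\mathcal J_{\neg}$ consists of the rules of $\mathcal J$ together with, for each $B\in\mathcal C$, letting $r_1,\dots,r_n$ ($n\ge0$) be the rules of $\tilde{\mathcal J}$ with conclusion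 $B$ and $A^i_1,\dots,A^i_{m_i}$ the premises of $r_i$, all rules $\frac{\neg A^1_{j_1}\ \cdots\ \neg A^n_{j_n}}{\neg B}$ for $1\le j_i\le m_i$ (the single rule $\frac{}{\neg B}$ if $n=0$). $\mathcal I_{\neg}$ and $\mathcal I'_{\neg}$ are this construction applied to $\mathcal J=\mathcal I$ and $\mathcal J=\mathcal I'$ respectively. -}

module Defs where

open import Data.Nat using (ℕ)
open import Data.Bool using (Bool; true; false; _∧_)
open import Data.Fin using (Fin)
open import Data.Fin.Subset using (Subset; _∪_; ⋃) renaming (_∈_ to _∈ₛ_)
open import Data.List using (List; []; _∷_; map; _++_; filterᵇ; allFin)
open import Data.List.Membership.Propositional using (_∈_)
open import Data.List.Relation.Unary.All using (All)
open import Data.Vec using (lookup)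
open import Data.Product using (Σ; _×_; _,_)
open import Data.Unit using (⊤)
open import Data.Empty using (⊥)
open import Relation.Binary.PropositionalEquality using (_≡_)

module _ {nS nΓ : ℕ} where

  State : Set
  State = Fin nS

  Sym : Set
  Sym = Fin nΓ

  -- closed words γ₁(⋯γₙ(ε)) as the list [γ₁,…,γₙ]
  Word : Set
  Word = List Sym

  Config : Set
  Config = State × Word

  data CProp : Set where
    cpos : Config → CProp
    cneg : Config → CProp

  -- terms possibly containing x:  γ₁(⋯γₖ(x))  or  γ₁(⋯γₖ(ε))
  data Tail : Set where
    var : Tail
    eps : Tail

  Term : Set
  Term = List Sym × Tail

  Atom : Set
  Atom = State × Term

  data Lit : Set where
    pos : Atom → Lit
    neg : Atom → Lit

  record Rule : Set where
    constructor _⇒_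
    field
      prems : List Lit
      concl : Lit
  open Rule public

  substAtom : Word → Atom → Config
  substAtom w (P , (ws , var)) = (P , ws ++ w)
  substAtom w (P , (ws , eps)) = (P , ws)

  substLit : Word → Lit → CProp
  substLit w (pos a) = cpos (substAtom w a)
  substLit w (neg a) = cneg (substAtom w a)

  instTerm : Term → Term → Term
  instTerm t (ws , var) = (ws ++ Data.Product.proj₁ t , Data.Product.proj₂ t)
  instTerm t (ws , eps) = (ws , eps)

  instLit : Term → Lit → Lit
  instLit t (pos (P , u)) = pos (P , instTerm t u)
  instLit t (neg (P , u)) = neg (P , instTerm t u)

  instRule : Term → Rule → Rule
  instRule t (ps ⇒ c) = map (instLit t) ps ⇒ instLit t c

  System : Set₁
  System = Rule → Set

  data Provable (J : System) : CProp → Set where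
    node : (r : Rule) (w : Word) → J r →
           All (Provable J) (map (substLit w) (prems r)) →
           Provable J (substLit w (concl r))

  -- Small step alternating pushdown systems.  Premises are sets, so
  -- sets of states are represented as Subset nS.

  data SRule : Set where
    -- P₁(x) ⋯ Pₙ(x) / Q(γx)     (premises = S)
    intro   : Sym → Subset nS → State → SRule
    -- / Q(ε)
    introε  : State → SRule
    -- P₁(γx) P₂(x) ⋯ Pₙ(x) / Q(x)   (P₁, γ, {P₂,…,Pₙ} = S, Q)
    elim    : State → Sym → Subset nS → State → SRule
    -- P₁(x) ⋯ Pₙ(x) / Q(x)
    neutral : Subset nS → State → SRule

  IsIntro : SRule → Set
  IsIntro (intro _ _ _)   = ⊤
  IsIntro (introε _)      = ⊤
  IsIntro (elim _ _ _ _)  = ⊥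
  IsIntro (neutral _ _)   = ⊥

  NotIntro : SRule → Set
  NotIntro (intro _ _ _)   = ⊥
  NotIntro (introε _)      = ⊥
  NotIntro (elim _ _ _ _)  = ⊤
  NotIntro (neutral _ _)   = ⊤

  members : Subset nS → List State
  members S = filterᵇ (lookup S) (allFin nS)

  xT : Term
  xT = ([] , var)

  γxT : Sym → Term
  γxT γ = (γ ∷ [] , var)

  εT : Term
  εT = ([] , eps)

  atomsAt : Subset nS → Term → List Lit
  atomsAt S t = map (λ P → pos (P , t)) (members S)

  toRule : SRule → Rule
  toRule (intro γ S Q)    = atomsAt S xT ⇒ pos (Q , γxT γ)
  toRule (introε Q)       = [] ⇒ pos (Q , εT)
  toRule (elim P₁ γ S Q)  = (pos (P₁ , γxT γ) ∷ atomsAt S xT) ⇒ pos (Q , xT)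
  toRule (neutral S Q)    = atomsAt S xT ⇒ pos (Q , xT)

  unionOver : Subset nS → (State → Subset nS) → Subset nS
  unionOver Qs f = ⋃ (map f (members Qs))

  data Sat (I : List SRule) : SRule → Set where
    base  : ∀ {s} → s ∈ I → Sat I s
    rule1 : ∀ {Ps Q₁ γ Qs R} →
            Sat I (intro γ Ps Q₁) → Sat I (elim Q₁ γ Qs R) →
            Sat I (neutral (Ps ∪ Qs) R)
    rule2 : ∀ {Qs R γ} (pick : State → Subset nS) →
            (∀ Q → Q ∈ₛ Qs → Sat I (intro γ (pick Q) Q)) →
            Sat I (neutral Qs R) →
            Sat I (intro γ (unionOver Qs pick) R)
    rule3 : ∀ {Qs R} →
            (∀ Q → Q ∈ₛ Qs → Sat I (introε Q)) →
            Sat I (neutral Qs R) →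
            Sat I (introε R)

  I′ : List SRule → SRule → Set
  I′ I s = Sat I s × IsIntro s

  data Tilde (J : SRule → Set) : Rule → Set where
    tIntro : ∀ {s} → J s → IsIntro s → Tilde J (toRule s)
    tEps   : ∀ {s} → J s → NotIntro s → Tilde J (instRule εT (toRule s))
    tPush  : ∀ {s} (γ : Sym) → J s → NotIntro s →
             Tilde J (instRule (γxT γ) (toRule s))

  data InC : Atom → Set where
    inCε : ∀ P → InC (P , εT)
    inCγ : ∀ P γ → InC (P , γxT γ)

  -- J_¬ : the rules of J together with, for each B ∈ 𝒞, the rules
  -- ¬A¹_{j₁} ⋯ ¬Aⁿ_{jₙ} / ¬B, one premise chosen (by c) from each rule
  -- r of J̃ with conclusion B; the premise set is exactly the image of
  -- the choice.
  data NegSys (J : SRule → Set) : Rule → Set where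
    old  : ∀ {s} → J s → NegSys J (toRule s)
    new  : ∀ (B : Atom) → InC B → (N : List Lit) (c : Rule → Atom) →
           (∀ r → Tilde J r → concl r ≡ pos B → pos (c r) ∈ prems r) →
           (∀ l → l ∈ N →
              Σ Rule λ r → Tilde J r × concl r ≡ pos B × l ≡ neg (c r)) →
           (∀ r → Tilde J r → concl r ≡ pos B → neg (c r) ∈ N) →
           NegSys J (N ⇒ neg B)

  I¬ : List SRule → System
  I¬ I = NegSys (λ s → s ∈ I)

  I′¬ : List SRule → System
  I′¬ I = NegSys (I′ I)

module Submission where

-- Proof of Lemma 11.  Let ¬A be provable in I′_¬.  Its last rule cannot be
-- a rule of I′ (those conclude atoms), so it is a new rule ¬C₁⋯¬Cₚ / ¬B
-- with B ∈ 𝒞 and A = σB, σ = [x := w].  To build a rule of I_¬ concluding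
-- ¬B we use a semantics of positive provability in I′: Pos P w, defined by
-- recursion on w from the introduction rules of the saturation I_s.
--   * Every rule of Ĩ preserves Pos (soundness of the saturation rules).
--   * Consistency: if ¬X is provable in I′_¬ then ¬ Pos X.
--   * Completeness: if ¬ Pos X then ¬X is provable in I′_¬.
-- Hence σB fails Pos, so every rule of Ĩ concluding B has a premise
-- failing Pos at w, which is refutable by completeness; choosing such a
-- premise for each of these rules yields the required rule of I_¬.
-- Choosing these premises constructively needs Pos to be decidable, which
-- rests on the decidability of membership in I_s; that is obtained by
-- forward chaining over the finitely many instances of the saturation rules.

open import Defs
open import Data.Bool using (Bool; true; false; T; T?)
import Data.Bool.Properties as Bool
open import Data.Empty using (⊥-elim)
open import Data.Fin using (Fin)
import Data.Fin.Properties as Fin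
open import Data.Fin.Subset using (Subset; _∪_; ⋃) renaming (_∈_ to _∈ₛ_; ⊥ to ∅)
open import Data.Fin.Subset.Properties using (x∈p∪q⁻; ∉⊥; anySubset?) renaming (_∈?_ to _∈ₛ?_)
open import Data.List
  using (List; []; _∷_; [_]; map; _++_; filter; length; allFin; concatMap; cartesianProduct; cartesianProductWith)
import Data.List.Properties as List
open import Data.List.Membership.Propositional using (_∈_; _∉_; find; lose)
open import Data.List.Membership.Propositional.Properties
  using ( ∈-allFin; ∈-map⁺; ∈-map⁻; ∈-++⁺ˡ; ∈-++⁺ʳ; ∈-filter⁺; ∈-filter⁻; ∈-concatMap⁺
        ; ∈-cartesianProduct⁺; ∈-cartesianProductWith⁺)
open import Data.List.Relation.Binary.Subset.Propositional using (_⊆_)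
open import Data.List.Relation.Unary.All as All using (All; []; _∷_)
import Data.List.Relation.Unary.All.Properties as All
open import Data.List.Relation.Unary.Any using (here; there; any?)
open import Data.Nat using (ℕ; zero; suc; _<_; _≤_; s≤s)
open import Data.Nat.Induction using (<-wellFounded)
open import Data.Nat.Properties using (m≤n⇒m≤1+n; ≤-refl)
open import Data.Product using (Σ; _×_; _,_; proj₁; proj₂; uncurry; map₁)
import Data.Product.Properties as Product
open import Data.Sum using (_⊎_; inj₁; inj₂; [_,_]′)
import Data.Sum.Properties as Sum
open import Data.Unit using (⊤; tt)
open import Data.Vec using (Vec; lookup; tabulate) renaming ([] to []ᵥ; _∷_ to _∷ᵥ_)
import Data.Vec.Properties as Vec
open import Function using (_∘_; id; Equivalence)
open import Induction.WellFounded using (Acc; acc)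
open import Relation.Binary.Definitions using (DecidableEquality)
open import Relation.Binary.PropositionalEquality using (_≡_; refl; sym; trans; cong; subst)
open import Relation.Nullary using (¬_; Dec; yes; no; ¬?; _×-dec_; _→-dec_; contradiction)
open import Relation.Nullary.Decidable using (map′; decidable-stable)
open import Relation.Unary using (Decidable)

record Finite (A : Set) : Set where
  field
    elements   : List A
    ∈-elements : ∀ a → a ∈ elements
open Finite

finite-Fin : ∀ n → Finite (Fin n)
finite-Fin n = record { elements = allFin n ; ∈-elements = ∈-allFin }

finite-Bool : Finite Bool
finite-Bool = record
  { elements   = true ∷ false ∷ []
  ; ∈-elements = λ { true → here refl ; false → there (here refl) } }

infixr 3 _×ᶠ_
infixr 2 _⊎ᶠ_

_×ᶠ_ : ∀ {A B} → Finite A → Finite B → Finite (A × B)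
fa ×ᶠ fb = record
  { elements   = cartesianProduct (elements fa) (elements fb)
  ; ∈-elements = λ (a , b) → ∈-cartesianProduct⁺ (∈-elements fa a) (∈-elements fb b) }

_⊎ᶠ_ : ∀ {A B} → Finite A → Finite B → Finite (A ⊎ B)
fa ⊎ᶠ fb = record
  { elements   = map inj₁ (elements fa) ++ map inj₂ (elements fb)
  ; ∈-elements = λ { (inj₁ a) → ∈-++⁺ˡ (∈-map⁺ inj₁ (∈-elements fa a))
                   ; (inj₂ b) → ∈-++⁺ʳ _ (∈-map⁺ inj₂ (∈-elements fb b)) } }

finite-Vec : ∀ {A} → Finite A → ∀ n → Finite (Vec A n)
finite-Vec fa zero    = record { elements = [ []ᵥ ] ; ∈-elements = λ { []ᵥ → here refl } }
finite-Vec fa (suc n) = record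
  { elements   = cartesianProductWith _∷ᵥ_ (elements fa) (elements (finite-Vec fa n))
  ; ∈-elements = λ { (a ∷ᵥ v) →
      ∈-cartesianProductWith⁺ _∷ᵥ_ (∈-elements fa a) (∈-elements (finite-Vec fa n) v) } }

finite-Subset : ∀ n → Finite (Subset n)
finite-Subset = finite-Vec finite-Bool

finite-retract : ∀ {A B} (to : A → B) (from : B → A) → (∀ a → from (to a) ≡ a) → Finite B → Finite A
finite-retract to from from-to fb = record
  { elements   = map from (elements fb)
  ; ∈-elements = λ a → subst (_∈ map from (elements fb)) (from-to a) (∈-map⁺ from (∈-elements fb (to a))) }

-- This is the termination measure of forward chaining.
module _ {A : Set} {P Q : A → Set} (P? : Decidable P) (Q? : Decidable Q) (P⇒Q : ∀ {x} → P x → Q x) where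

  filter-mono : ∀ xs → length (filter P? xs) ≤ length (filter Q? xs)
  filter-mono []       = ≤-refl
  filter-mono (x ∷ xs) with P? x | Q? x
  ... | yes _  | yes _  = s≤s (filter-mono xs)
  ... | yes px | no ¬qx = contradiction (P⇒Q px) ¬qx
  ... | no _   | yes _  = m≤n⇒m≤1+n (filter-mono xs)
  ... | no _   | no _   = filter-mono xs

  filter-shrinks : ∀ {x xs} → x ∈ xs → Q x → ¬ P x → length (filter P? xs) < length (filter Q? xs)
  filter-shrinks {xs = y ∷ xs} (here refl) qx ¬px with P? y | Q? y
  ... | yes px | _      = contradiction px ¬px
  ... | no _   | yes _  = s≤s (filter-mono xs)
  ... | no _   | no ¬qx = contradiction qx ¬qx
  filter-shrinks {xs = y ∷ xs} (there x∈) qx ¬px with P? y | Q? y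
  ... | yes _  | yes _  = s≤s (filter-shrinks x∈ qx ¬px)
  ... | yes py | no ¬qy = contradiction (P⇒Q py) ¬qy
  ... | no _   | yes _  = m≤n⇒m≤1+n (filter-shrinks x∈ qx ¬px)
  ... | no _   | no _   = filter-shrinks x∈ qx ¬px

module ForwardChaining {A : Set} (_≟_ : DecidableEquality A) (D : A → Set) where
  open import Data.List.Membership.DecPropositional _≟_ using (_∈?_)

  record Clause : Set where
    field
      premises   : List A
      conclusion : A
      derive     : All D premises → D conclusion
  open Clause public

  Closed : List Clause → List A → Set
  Closed cs Z = ∀ {c} → c ∈ cs → All (_∈ Z) (premises c) → conclusion c ∈ Z

  module _ (cs : List Clause) where

    Fires : List A → Clause → Set
    Fires Z c = All (_∈ Z) (premises c) × conclusion c ∉ Z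

    fires? : ∀ Z → Decidable (Fires Z)
    fires? Z c = All.all? (_∈? Z) (premises c) ×-dec ¬? (conclusion c ∈? Z)

    pending : List A → List A
    pending Z = filter (λ a → ¬? (a ∈? Z)) (map conclusion cs)

    firing-shrinks : ∀ {c Z} → c ∈ cs → conclusion c ∉ Z →
                     length (pending (conclusion c ∷ Z)) < length (pending Z)
    firing-shrinks c∈ fresh =
      filter-shrinks _ _ (λ a∉ a∈ → a∉ (there a∈))
        (∈-map⁺ conclusion c∈) fresh (λ a∉ → a∉ (here refl))

    saturate : ∀ Z → All D Z → Acc _<_ (length (pending Z)) →
               Σ (List A) λ Z′ → Z ⊆ Z′ × All D Z′ × Closed cs Z′
    saturate Z dZ (acc smaller) with any? (fires? Z) cs
    ... | yes firing with find firing
    ...   | c , c∈ , ready , fresh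
            with saturate (conclusion c ∷ Z) (derive c (All.map (All.lookup dZ) ready) ∷ dZ)
                          (smaller (firing-shrinks c∈ fresh))
    ...     | Z′ , Z⊆Z′ , dZ′ , closed = Z′ , Z⊆Z′ ∘ there , dZ′ , closed
    saturate Z dZ _ | no quiet =
      Z , id , dZ , λ c∈ ready → decidable-stable (_ ∈? Z) (λ fresh → quiet (lose c∈ (ready , fresh)))

    decide : ∀ {Z₀} → All D Z₀ →
             (∀ {Z} → Z₀ ⊆ Z → Closed cs Z → ∀ {a} → D a → a ∈ Z) → Decidable D
    decide {Z₀} dZ₀ least a with saturate Z₀ dZ₀ (<-wellFounded _)
    ... | Z , Z₀⊆Z , dZ , closed with a ∈? Z
    ...   | yes a∈Z = yes (All.lookup dZ a∈Z)
    ...   | no  a∉Z = no λ da → a∉Z (least Z₀⊆Z closed da)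

Listing : {A : Set} → (A → Set) → Set
Listing {A} J = Σ (List (Σ A J)) λ L → ∀ {a} → J a → a ∈ map proj₁ L

listing : ∀ {A : Set} {J : A → Set} (xs : List A) → (∀ {a} → J a → a ∈ xs) → Decidable J → Listing J
listing {A} {J} xs covers J? = witnesses xs , λ j → witnessed (covers j) j
  where
  witnesses : List A → List (Σ A J)
  witnesses []       = []
  witnesses (x ∷ xs) with J? x
  ... | yes j = (x , j) ∷ witnesses xs
  ... | no  _ = witnesses xs

  witnessed : ∀ {a xs} → a ∈ xs → J a → a ∈ map proj₁ (witnesses xs)
  witnessed {xs = x ∷ xs} (here refl) j with J? x
  ... | yes _  = here refl
  ... | no  ¬j = contradiction j ¬j
  witnessed {xs = x ∷ xs} (there a∈) j with J? x
  ... | yes _ = there (witnessed a∈ j)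
  ... | no  _ = witnessed a∈ j

∈-⋃⁻ : ∀ {n} {A : Set} (f : A → Subset n) (as : List A) {x} →
       x ∈ₛ ⋃ (map f as) → Σ A λ a → x ∈ₛ f a
∈-⋃⁻ f []       x∈ = ⊥-elim (∉⊥ x∈)
∈-⋃⁻ f (a ∷ as) x∈ with x∈p∪q⁻ (f a) (⋃ (map f as)) x∈
... | inj₁ x∈fa   = a , x∈fa
... | inj₂ x∈rest = ∈-⋃⁻ f as x∈rest

infixr 3 _×-≟_
infixr 2 _⊎-≟_

_×-≟_ : ∀ {A B : Set} → DecidableEquality A → DecidableEquality B → DecidableEquality (A × B)
_≟a_ ×-≟ _≟b_ = Product.≡-dec _≟a_ _≟b_

_⊎-≟_ : ∀ {A B : Set} → DecidableEquality A → DecidableEquality B → DecidableEquality (A ⊎ B)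
_≟a_ ⊎-≟ _≟b_ = Sum.≡-dec _≟a_ _≟b_

module _ {nS nΓ : ℕ} where

  members⁺ : ∀ {S : Subset nS} {Q} → Q ∈ₛ S → Q ∈ members {nS} {nΓ} S
  members⁺ {S} {Q} Q∈S = ∈-filter⁺ (T? ∘ lookup S) (∈-allFin Q) (subst T (sym (Vec.[]=⇒lookup Q∈S)) tt)

  members⁻ : ∀ {S : Subset nS} {Q} → Q ∈ members {nS} {nΓ} S → Q ∈ₛ S
  members⁻ {S} {Q} Q∈ =
    Vec.lookup⇒[]= Q S (Equivalence.to Bool.T-≡ (proj₂ (∈-filter⁻ (T? ∘ lookup S) {xs = allFin nS} Q∈)))

  private
    Code : Set
    Code = (Fin nΓ × Subset nS × Fin nS) ⊎ Fin nS
         ⊎ (Fin nS × Fin nΓ × Subset nS × Fin nS) ⊎ (Subset nS × Fin nS)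

    encode : SRule {nS} {nΓ} → Code
    encode (intro γ S Q)  = inj₁ (γ , S , Q)
    encode (introε Q)     = inj₂ (inj₁ Q)
    encode (elim P γ S Q) = inj₂ (inj₂ (inj₁ (P , γ , S , Q)))
    encode (neutral S Q)  = inj₂ (inj₂ (inj₂ (S , Q)))

    decode : Code → SRule {nS} {nΓ}
    decode (inj₁ (γ , S , Q))                   = intro γ S Q
    decode (inj₂ (inj₁ Q))                      = introε Q
    decode (inj₂ (inj₂ (inj₁ (P , γ , S , Q)))) = elim P γ S Q
    decode (inj₂ (inj₂ (inj₂ (S , Q))))         = neutral S Q

    decode-encode : ∀ s → decode (encode s) ≡ s
    decode-encode (intro _ _ _)  = refl
    decode-encode (introε _)     = refl
    decode-encode (elim _ _ _ _) = refl
    decode-encode (neutral _ _)  = refl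

    _≟ₛ_ : DecidableEquality (Subset nS)
    _≟ₛ_ = Vec.≡-dec Bool._≟_

    _≟ᶜ_ : DecidableEquality Code
    _≟ᶜ_ = (Fin._≟_ ×-≟ _≟ₛ_ ×-≟ Fin._≟_) ⊎-≟ Fin._≟_
         ⊎-≟ (Fin._≟_ ×-≟ Fin._≟_ ×-≟ _≟ₛ_ ×-≟ Fin._≟_) ⊎-≟ (_≟ₛ_ ×-≟ Fin._≟_)

    finite-Code : Finite Code
    finite-Code = (finite-Fin nΓ ×ᶠ finite-Subset nS ×ᶠ finite-Fin nS) ⊎ᶠ finite-Fin nS
                ⊎ᶠ (finite-Fin nS ×ᶠ finite-Fin nΓ ×ᶠ finite-Subset nS ×ᶠ finite-Fin nS)
                ⊎ᶠ (finite-Subset nS ×ᶠ finite-Fin nS)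

  _≟ˢ_ : DecidableEquality (SRule {nS} {nΓ})
  s ≟ˢ t = map′ injective (cong encode) (encode s ≟ᶜ encode t)
    where
    injective : encode s ≡ encode t → s ≡ t
    injective eq = trans (sym (decode-encode s)) (trans (cong decode eq) (decode-encode t))

  finite-SRule : Finite (SRule {nS} {nΓ})
  finite-SRule = finite-retract encode decode decode-encode finite-Code

  _≟ᵗ_ : DecidableEquality (Tail {nS} {nΓ})
  var ≟ᵗ var = yes refl
  eps ≟ᵗ eps = yes refl
  var ≟ᵗ eps = no λ ()
  eps ≟ᵗ var = no λ ()

  _≟ˡ_ : DecidableEquality (Lit {nS} {nΓ})
  pos a ≟ˡ pos b = map′ (cong pos) (λ { refl → refl }) (≟-atom a b)
    where ≟-atom = Fin._≟_ ×-≟ List.≡-dec Fin._≟_ ×-≟ _≟ᵗ_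
  neg a ≟ˡ neg b = map′ (cong neg) (λ { refl → refl }) (≟-atom a b)
    where ≟-atom = Fin._≟_ ×-≟ List.≡-dec Fin._≟_ ×-≟ _≟ᵗ_
  pos _ ≟ˡ neg _ = no λ ()
  neg _ ≟ˡ pos _ = no λ ()

  substTerm : Word {nS} {nΓ} → Term {nS} {nΓ} → Word {nS} {nΓ}
  substTerm w (ws , var) = ws ++ w
  substTerm w (ws , eps) = ws

  subst-inst : ∀ w t (l : Lit {nS} {nΓ}) → substLit w (instLit t l) ≡ substLit (substTerm w t) l
  subst-inst w (ts , var) (pos (P , (ws , var))) = cong (λ v → cpos (P , v)) (List.++-assoc ws ts w)
  subst-inst w (ts , eps) (pos (P , (ws , var))) = refl
  subst-inst w t          (pos (P , (ws , eps))) = refl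
  subst-inst w (ts , var) (neg (P , (ws , var))) = cong (λ v → cneg (P , v)) (List.++-assoc ws ts w)
  subst-inst w (ts , eps) (neg (P , (ws , var))) = refl
  subst-inst w t          (neg (P , (ws , eps))) = refl

module _ {nS nΓ : ℕ} {J : SRule {nS} {nΓ} → Set} where

  tildes : ∀ s → J s → List (Σ Rule (Tilde J))
  tildes (intro γ S Q)  j = [ _ , tIntro j tt ]
  tildes (introε Q)     j = [ _ , tIntro j tt ]
  tildes (elim P γ S Q) j = (_ , tEps j tt) ∷ map (λ γ′ → _ , tPush γ′ j tt) (allFin nΓ)
  tildes (neutral S Q)  j = (_ , tEps j tt) ∷ map (λ γ′ → _ , tPush γ′ j tt) (allFin nΓ)

  tilde-origin : ∀ {r} → Tilde J r → Σ SRule λ s → J s × (∀ j → r ∈ map proj₁ (tildes s j))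
  tilde-origin (tIntro {intro _ _ _} j _)   = _ , j , λ _ → here refl
  tilde-origin (tIntro {introε _} j _)      = _ , j , λ _ → here refl
  tilde-origin (tEps {elim _ _ _ _} j _)    = _ , j , λ _ → here refl
  tilde-origin (tEps {neutral _ _} j _)     = _ , j , λ _ → here refl
  tilde-origin (tPush {elim _ _ _ _} γ j _) =
    _ , j , λ j′ → there (∈-map⁺ proj₁ (∈-map⁺ (λ γ′ → _ , tPush γ′ j′ tt) (∈-allFin γ)))
  tilde-origin (tPush {neutral _ _} γ j _)  =
    _ , j , λ j′ → there (∈-map⁺ proj₁ (∈-map⁺ (λ γ′ → _ , tPush γ′ j′ tt) (∈-allFin γ)))

  tilde-listing : Listing J → Listing (Tilde J)
  tilde-listing (L , listed) = concatMap (uncurry tildes) L , tilde-listed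
    where
    tilde-listed : ∀ {r} → Tilde J r → r ∈ map proj₁ (concatMap (uncurry tildes) L)
    tilde-listed t with tilde-origin t
    ... | s , j , from-s with ∈-map⁻ proj₁ (listed j)
    ...   | (_ , j′) , s∈L , refl =
            subst (_ ∈_) (sym (List.map-concatMap proj₁ (uncurry tildes) L))
              (∈-concatMap⁺ (map proj₁ ∘ uncurry tildes) (lose s∈L (from-s j′)))

  PremisesRefuted : Atom {nS} {nΓ} → Word {nS} {nΓ} → Set
  PremisesRefuted B w = ∀ {r} → Tilde J r → concl r ≡ pos B →
    Σ Atom λ C → pos C ∈ prems r × Provable (NegSys J) (cneg (substAtom w C))

  -- Inversion: the last rule of a proof of ¬A in J_¬ is a new rule, since
  -- the rules of J conclude atoms.
  neg-inversion : ∀ {A} → Provable (NegSys J) (cneg A) →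
    Σ Atom λ B → InC B × Σ (Word {nS} {nΓ}) λ w → substAtom w B ≡ A × PremisesRefuted B w
  neg-inversion ¬A = last-step ¬A refl
    where
    last-step : ∀ {X A} → Provable (NegSys J) X → X ≡ cneg A →
      Σ Atom λ B → InC B × Σ (Word {nS} {nΓ}) λ w → substAtom w B ≡ A × PremisesRefuted B w
    last-step (node _ _ (old {intro _ _ _} _) _)  ()
    last-step (node _ _ (old {introε _} _) _)     ()
    last-step (node _ _ (old {elim _ _ _ _} _) _) ()
    last-step (node _ _ (old {neutral _ _} _) _)  ()
    last-step (node _ w (new B B∈𝒞 N c chosen _ complete) premises) refl =
      B , B∈𝒞 , w , refl ,
      λ {r} t e → c r , chosen r t e , All.lookup premises (∈-map⁺ (substLit w) (complete r t e))

module Saturation {nS nΓ : ℕ} (I : List (SRule {nS} {nΓ})) where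
  open ForwardChaining _≟ˢ_ (Sat I)

  -- The closure rules (1)-(3) with all possible parameters, as Horn
  -- clauses; in (2) the choice function is given by a vector of subsets.
  clause₁ : Fin nΓ × Subset nS × Fin nS × Subset nS × Fin nS → Clause
  clause₁ (γ , Ps , Q , Qs , R) = record
    { premises   = intro γ Ps Q ∷ elim Q γ Qs R ∷ []
    ; conclusion = neutral (Ps ∪ Qs) R
    ; derive     = λ { (i ∷ e ∷ []) → rule1 i e } }

  clause₂ : Fin nΓ × Subset nS × Fin nS × Vec (Subset nS) nS → Clause
  clause₂ (γ , Qs , R , picks) = record
    { premises   = neutral Qs R ∷ map (λ Q → intro γ (lookup picks Q) Q) (members {nΓ = nΓ} Qs)
    ; conclusion = intro γ (unionOver {nΓ = nΓ} Qs (lookup picks)) R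
    ; derive     = λ { (n ∷ is) →
        rule2 (lookup picks) (λ Q → All.lookup (All.map⁻ is) ∘ members⁺ {nΓ = nΓ}) n } }

  clause₃ : Subset nS × Fin nS → Clause
  clause₃ (Qs , R) = record
    { premises   = neutral Qs R ∷ map introε (members {nΓ = nΓ} Qs)
    ; conclusion = introε R
    ; derive     = λ { (n ∷ es) → rule3 (λ Q → All.lookup (All.map⁻ es) ∘ members⁺ {nΓ = nΓ}) n } }

  params₁ : Finite (Fin nΓ × Subset nS × Fin nS × Subset nS × Fin nS)
  params₁ = finite-Fin nΓ ×ᶠ finite-Subset nS ×ᶠ finite-Fin nS ×ᶠ finite-Subset nS ×ᶠ finite-Fin nS

  params₂ : Finite (Fin nΓ × Subset nS × Fin nS × Vec (Subset nS) nS)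
  params₂ = finite-Fin nΓ ×ᶠ finite-Subset nS ×ᶠ finite-Fin nS ×ᶠ finite-Vec (finite-Subset nS) nS

  params₃ : Finite (Subset nS × Fin nS)
  params₃ = finite-Subset nS ×ᶠ finite-Fin nS

  clauses : List Clause
  clauses = map clause₁ (elements params₁)
         ++ map clause₂ (elements params₂)
         ++ map clause₃ (elements params₃)

  clause₁∈ : ∀ p → clause₁ p ∈ clauses
  clause₁∈ p = ∈-++⁺ˡ (∈-map⁺ clause₁ (∈-elements params₁ p))

  clause₂∈ : ∀ p → clause₂ p ∈ clauses
  clause₂∈ p = ∈-++⁺ʳ (map clause₁ (elements params₁))
                 (∈-++⁺ˡ (∈-map⁺ clause₂ (∈-elements params₂ p)))

  clause₃∈ : ∀ p → clause₃ p ∈ clauses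
  clause₃∈ p = ∈-++⁺ʳ (map clause₁ (elements params₁))
                 (∈-++⁺ʳ (map clause₂ (elements params₂)) (∈-map⁺ clause₃ (∈-elements params₃ p)))

  module _ {Z : List (SRule {nS} {nΓ})} (I⊆Z : I ⊆ Z) (closed : Closed clauses Z) where

    sat-in-closed : ∀ {s} → Sat I s → s ∈ Z
    sat-in-closed (base s∈I)  = I⊆Z s∈I
    sat-in-closed (rule1 i e) = closed (clause₁∈ _) (sat-in-closed i ∷ sat-in-closed e ∷ [])
    sat-in-closed (rule2 {Qs} {R} {γ} pick picked n) =
      subst (λ S → intro γ S R ∈ Z) tabulated-union
        (closed (clause₂∈ (γ , Qs , R , tabulate pick)) (sat-in-closed n ∷ All.map⁺ (All.tabulate premise)))
      where
      premise : ∀ {Q} → Q ∈ members {nΓ = nΓ} Qs → intro γ (lookup (tabulate pick) Q) Q ∈ Z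
      premise {Q} Q∈ = subst (λ T → intro γ T Q ∈ Z) (sym (Vec.lookup∘tabulate pick Q))
                         (sat-in-closed (picked Q (members⁻ {nΓ = nΓ} Q∈)))

      tabulated-union : unionOver {nΓ = nΓ} Qs (lookup (tabulate pick)) ≡ unionOver {nΓ = nΓ} Qs pick
      tabulated-union = cong ⋃ (List.map-cong (Vec.lookup∘tabulate pick) (members {nΓ = nΓ} Qs))
    sat-in-closed (rule3 {Qs} {R} axioms n) =
      closed (clause₃∈ (Qs , R))
        (sat-in-closed n ∷
         All.map⁺ (All.tabulate λ Q∈ → sat-in-closed (axioms _ (members⁻ {nΓ = nΓ} Q∈))))

  sat? : Decidable (Sat I)
  sat? = decide clauses (All.tabulate base) sat-in-closed

module Positive {nS nΓ : ℕ} (I : List (SRule {nS} {nΓ})) where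
  open Saturation I using (sat?)

  -- Pos P w: the configuration P(w) is provable with the introduction rules
  -- of the saturation, i.e. in I′.
  Pos : Fin nS → Word {nS} {nΓ} → Set
  Pos P []      = Sat I (introε P)
  Pos P (γ ∷ w) = Σ (Subset nS) λ T → Sat I (intro γ T P) × (∀ P′ → P′ ∈ₛ T → Pos P′ w)

  pos? : ∀ P w → Dec (Pos P w)
  pos? P []      = sat? (introε P)
  pos? P (γ ∷ w) =
    anySubset? λ T → sat? (intro γ T P) ×-dec Fin.all? (λ P′ → P′ ∈ₛ? T →-dec pos? P′ w)

  Holds : CProp {nS} {nΓ} → Set
  Holds (cpos (P , w)) = Pos P w
  Holds (cneg _)       = ⊤

  holds? : ∀ (p : CProp {nS} {nΓ}) → Dec (Holds p)
  holds? (cpos (P , w)) = pos? P w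
  holds? (cneg _)       = yes tt

  HoldsAt : Word {nS} {nΓ} → Lit {nS} {nΓ} → Set
  HoldsAt w = Holds ∘ substLit w

  atoms-hold : ∀ {S w} → All (HoldsAt w) (atomsAt S xT) → ∀ P → P ∈ₛ S → Pos P w
  atoms-hold hold P P∈S = All.lookup (All.map⁻ hold) (members⁺ {nΓ = nΓ} P∈S)

  -- A neutral rule of the saturation preserves Pos at every word: at ε by
  -- closure rule (3), at γw by rule (2), choosing for each premise Q the
  -- set T that witnesses Pos Q (γ ∷ w).
  neutral-sound : ∀ {U R} w → Sat I (neutral U R) → (∀ P → P ∈ₛ U → Pos P w) → Pos R w
  neutral-sound []          n premises = rule3 premises n
  neutral-sound {U} (γ ∷ w) n premises =
    unionOver {nΓ = nΓ} U pick , rule2 pick (λ Q → proj₁ (proj₂ (choose Q))) n , covered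
    where
    choose : ∀ Q → Σ (Subset nS) λ T → (Q ∈ₛ U → Sat I (intro γ T Q)) × (∀ P → P ∈ₛ T → Pos P w)
    choose Q with Q ∈ₛ? U
    ... | yes Q∈U = let T , sT , posT = premises Q Q∈U in T , (λ _ → sT) , posT
    ... | no  Q∉U = ∅ , (λ Q∈U → contradiction Q∈U Q∉U) , (λ _ P∈∅ → ⊥-elim (∉⊥ P∈∅))

    pick : Fin nS → Subset nS
    pick Q = proj₁ (choose Q)

    covered : ∀ P → P ∈ₛ unionOver {nΓ = nΓ} U pick → Pos P w
    covered P P∈ = let Q , P∈pickQ = ∈-⋃⁻ pick (members {nΓ = nΓ} U) P∈ in
                   proj₂ (proj₂ (choose Q)) P P∈pickQ

  sat-sound : ∀ {s} → Sat I s → ∀ w → All (HoldsAt w) (prems (toRule s)) → HoldsAt w (concl (toRule s))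
  sat-sound {intro γ S Q}  sat w hold = S , sat , atoms-hold hold
  sat-sound {introε Q}     sat w _    = sat
  sat-sound {elim _ γ S Q} sat w ((T , sT , posT) ∷ hold) =
    neutral-sound w (rule1 sT sat) λ P P∈ → [ posT P , atoms-hold hold P ]′ (x∈p∪q⁻ T S P∈)
  sat-sound {neutral S Q}  sat w hold = neutral-sound w sat (atoms-hold hold)

  instance-sound : ∀ {s} → Sat I s → ∀ t w → All (HoldsAt w) (prems (instRule t (toRule s))) →
                   HoldsAt w (concl (instRule t (toRule s)))
  instance-sound {s} sat t w hold =
    subst Holds (sym (subst-inst w t (concl (toRule s))))
      (sat-sound sat (substTerm w t) (All.map (λ {l} → subst Holds (subst-inst w t l)) (All.map⁻ hold)))

  tilde-sound : ∀ {J : SRule → Set} → (∀ {s} → J s → Sat I s) →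
                ∀ {r} → Tilde J r → ∀ w → All (HoldsAt w) (prems r) → HoldsAt w (concl r)
  tilde-sound J⊆Sat (tIntro j _)  = sat-sound (J⊆Sat j)
  tilde-sound J⊆Sat (tEps j _)    = instance-sound (J⊆Sat j) εT
  tilde-sound J⊆Sat (tPush γ j _) = instance-sound (J⊆Sat j) (γxT γ)

module Negative {nS nΓ : ℕ} (I : List (SRule {nS} {nΓ})) where
  open Saturation I using (sat?)
  open Positive I
  open import Data.List.Membership.DecPropositional (_≟ˢ_ {nS} {nΓ}) using (_∈?_)

  Refutable : Config {nS} {nΓ} → Set
  Refutable X = Provable (I′¬ I) (cneg X)

  -- For each rule of J̃ concluding B we choose
  -- its first premise failing at w; one exists because J̃-rules preserve
  -- Pos.
  module NewRule {J : SRule → Set} (J⊆Sat : ∀ {s} → J s → Sat I s) (J̃ : Listing (Tilde J))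
                 (B : Atom {nS} {nΓ}) (B∈𝒞 : InC B) (w : Word {nS} {nΓ}) (¬B : ¬ HoldsAt w (pos B))
                 (refute : ∀ {r} → Tilde J r → concl r ≡ pos B →
                           ∀ {C} → pos C ∈ prems r → ¬ HoldsAt w (pos C) → Refutable (substAtom w C)) where

    -- The first positive literal failing at w (B if there is none).
    failing : List (Lit {nS} {nΓ}) → Atom {nS} {nΓ}
    failing []           = B
    failing (neg _ ∷ ls) = failing ls
    failing (pos C ∷ ls) with holds? (substLit w (pos C))
    ... | yes _ = failing ls
    ... | no  _ = C

    failing-fails : ∀ ls → ¬ All (HoldsAt w) ls → pos (failing ls) ∈ ls × ¬ HoldsAt w (pos (failing ls))
    failing-fails []           ¬all = contradiction [] ¬all
    failing-fails (neg _ ∷ ls) ¬all = map₁ there (failing-fails ls (¬all ∘ (tt ∷_)))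
    failing-fails (pos C ∷ ls) ¬all with holds? (substLit w (pos C))
    ... | yes h = map₁ there (failing-fails ls (¬all ∘ (h ∷_)))
    ... | no ¬h = here refl , ¬h

    choice : Rule → Atom
    choice r = failing (prems r)

    choice-fails : ∀ {r} → Tilde J r → concl r ≡ pos B →
                   pos (choice r) ∈ prems r × ¬ HoldsAt w (pos (choice r))
    choice-fails {r} t e = failing-fails (prems r) λ all → ¬B (subst (HoldsAt w) e (tilde-sound J⊆Sat t w all))

    relevant : List (Σ Rule (Tilde J))
    relevant = filter (λ rt → concl (proj₁ rt) ≟ˡ pos B) (proj₁ J̃)

    chosen : List Atom
    chosen = map (choice ∘ proj₁) relevant

    rule : NegSys J (map neg chosen ⇒ neg B)
    rule = new B B∈𝒞 (map neg chosen) choice (λ _ t e → proj₁ (choice-fails t e)) from-relevant all-relevant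
      where
      from-relevant : ∀ l → l ∈ map neg chosen →
                      Σ Rule λ r → Tilde J r × concl r ≡ pos B × l ≡ neg (choice r)
      from-relevant l l∈ with ∈-map⁻ neg l∈
      ... | C , C∈ , refl with ∈-map⁻ (choice ∘ proj₁) C∈
      ...   | (r , t) , rt∈ , refl = r , t , proj₂ (∈-filter⁻ _ {xs = proj₁ J̃} rt∈) , refl

      all-relevant : ∀ r → Tilde J r → concl r ≡ pos B → neg (choice r) ∈ map neg chosen
      all-relevant r t e with ∈-map⁻ proj₁ (proj₂ J̃ t)
      ... | (_ , t′) , rt∈ , refl = ∈-map⁺ neg (∈-map⁺ (choice ∘ proj₁) (∈-filter⁺ _ rt∈ e))

    chosen-refutable : All (Refutable ∘ substAtom w) chosen
    chosen-refutable = All.map⁺ (All.tabulate λ {(r , t)} rt∈ →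
      let e = proj₂ (∈-filter⁻ _ {xs = proj₁ J̃} rt∈) in
      refute t e (proj₁ (choice-fails t e)) (proj₂ (choice-fails t e)))

  I-listing : Listing (Tilde (λ s → s ∈ I))
  I-listing = tilde-listing (listing I id (_∈? I))

  I′-listing : Listing (Tilde (I′ I))
  I′-listing = tilde-listing (listing (elements finite-SRule) (λ {s} _ → ∈-elements finite-SRule s)
                                      (λ s → sat? s ×-dec intro? s))
    where
    intro? : ∀ s → Dec (IsIntro s)
    intro? (intro _ _ _)  = yes tt
    intro? (introε _)     = yes tt
    intro? (elim _ _ _ _) = no λ ()
    intro? (neutral _ _)  = no λ ()

  I′-premise : ∀ {r C} → Tilde (I′ I) r → pos C ∈ prems r →
    (Σ (Fin nS × Fin nΓ) λ (Q , γ) → concl r ≡ pos (Q , γxT γ)) × Σ (Fin nS) λ P → C ≡ (P , xT)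
  I′-premise (tIntro {intro γ T Q} _ _) C∈ with ∈-map⁻ (λ P → pos (P , xT)) C∈
  ... | P , _ , refl = ((Q , γ) , refl) , P , refl
  I′-premise (tIntro {introε _} _ _) ()
  I′-premise (tEps {intro _ _ _} _ ())
  I′-premise (tEps {introε _} _ ())
  I′-premise (tPush {intro _ _ _} _ _ ())
  I′-premise (tPush {introε _} _ _ ())

  refute-I′ : ∀ B → InC B → ∀ w → ¬ HoldsAt w (pos B) →
    (∀ {r} → Tilde (I′ I) r → concl r ≡ pos B → ∀ {C} → pos C ∈ prems r → ¬ HoldsAt w (pos C) →
       Refutable (substAtom w C)) →
    Refutable (substAtom w B)
  refute-I′ B B∈𝒞 w ¬B refute = node _ w rule (All.map⁺ (All.map⁺ chosen-refutable))
    where open NewRule proj₁ I′-listing B B∈𝒞 w ¬B refute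

  -- At ε the rules of Ĩ′ concluding P(ε) have no
  -- premises; at γw their premises are P′(x), refuted at w by induction.
  complete : ∀ P w → ¬ Pos P w → Refutable (P , w)
  complete P [] ¬P = refute-I′ (P , εT) (inCε P) [] ¬P λ t e C∈ _ → no-premise t e C∈
    where
    no-premise : ∀ {r C A} → Tilde (I′ I) r → concl r ≡ pos (P , εT) → pos C ∈ prems r → A
    no-premise t e C∈ with I′-premise t C∈
    ... | (_ , e′) , _ with trans (sym e) e′
    ...   | ()
  complete P (γ ∷ w) ¬P = refute-I′ (P , γxT γ) (inCγ P γ) w ¬P λ t _ C∈ ¬C → premise t C∈ ¬C
    where
    premise : ∀ {r C} → Tilde (I′ I) r → pos C ∈ prems r → ¬ HoldsAt w (pos C) →
              Refutable (substAtom w C)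
    premise t C∈ ¬C with I′-premise t C∈
    ... | _ , P′ , refl = complete P′ w ¬C

  -- Consistency of I′_¬, by induction on the word: nothing refutable is
  -- positively provable, since the witness of Pos gives a rule of Ĩ′ whose
  -- refuted premise is again positively provable.
  consistent : ∀ P w → Refutable (P , w) → ¬ Pos P w
  consistent P w ¬Pw Pw with neg-inversion ¬Pw
  ... | _ , inCε Q , _ , refl , refuted with refuted (tIntro {s = introε Q} (Pw , tt) tt) refl
  ...   | _ , () , _
  consistent _ _ ¬Pw (T , sT , posT) | _ , inCγ Q γ , w , refl , refuted
    with refuted (tIntro {s = intro γ T Q} (sT , tt) tt) refl
  ... | C , C∈ , ¬C with ∈-map⁻ (λ P → pos (P , xT)) C∈
  ...   | P′ , P′∈ , refl = consistent P′ w ¬C (posT P′ (members⁻ {nΓ = nΓ} P′∈))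

lemma11 : ∀ {nS nΓ : ℕ} (I : List (SRule {nS} {nΓ})) (A : Config {nS} {nΓ}) →
    Provable (I′¬ I) (cneg A) →
    Σ (List Atom) λ Cs → Σ Atom λ B →
      I¬ I (map neg Cs ⇒ neg B) ×
      Σ (Word {nS} {nΓ}) λ w → substAtom w B ≡ A ×
        All (λ C → Provable (I′¬ I) (cneg (substAtom w C))) Cs
lemma11 I A ¬A with neg-inversion ¬A
... | B , B∈𝒞 , w , refl , _ = chosen , B , rule , w , refl , chosen-refutable
  where
  open Negative I
  open NewRule base I-listing B B∈𝒞 w (consistent _ _ ¬A) (λ _ _ _ → complete _ _)
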